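{- Let $n \ge 3$ and $k$ be integers with $0 \le k \le n-3$. Define the sequence $P_{\min_{n,k}} = \{p_1, p_2, \ldots, p_n\}$ by $p_1 = 1$; $p_i = F(i-1)$ for $2 \le i \le k+2$; $p_{k+3} = F(k+2) = w_{F(k+2),0}$; and $p_i = w_{F(k+2),\, i-k-3}$ for $k+4 \le i \le n$. Then $P_{\min_{n,k}}$ is a minimizing $k$-ordered sequence of the elongated binary tree in the class $M_{n,k}$; that is, $P_{\min_{n,k}} \in M_{n,k}$ and the Huffman cost (weighted external path length of its elongated Huffman tree) of $P_{\min_{n,k}}$ is at most that of every sequence in $M_{n,k}$.
   Context: $F(i)$ denotes the $i$-th Fibonacci number: $F(0)=0$, $F(1)=1$, $F(i)=F(i-1)+F(i-2)$ for $i>1$. Let $\varphi=(1+\sqrt5)/2$. The (generalized) Wythoff array $(w_{i,j})_{i\ge 0, j\ge 0}$ is defined by $w_{i,0}=i$, $w_{i,1}=\lfloor (i+1)\varphi\rfloor$, and $w_{i,j}=w_{i,j-1}+w_{i,j-2}$ for $j\ge 2$. A (strictly) binary tree is an ordered rooted tree in which every non-leaf node has exactly two children; its size is its number of leaves. A binary tree is elongated if among any two sibling nodes at least one is a leaf. For a binary tree $T$ with positive weights $p_1,\dots,p_n$ at its leaves, the weighted external path length is $E(T,P)=\sum_{i=1}^n l_i p_i$, where $l_i$ is the length of the path from the root to leaf $i$. Huffman algorithm on a non-decreasing sequence $P=\{p_1,\dots,p_n\}$ of positive integers: set $P^{(0)}=P$; for $i=1,\dots,n-1$, the sequence $P^{(i)}=\{p^{(i)}_1,\dots,p^{(i)}_{n-i}\}$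 is obtained from $P^{(i-1)}$ by replacing its two first (smallest) entries $p^{(i-1)}_1,p^{(i-1)}_2$ by their sum and sorting the result in non-decreasing order; the merges define a binary tree (a Huffman tree of $P$), which minimizes $E(T,P)$ over all binary trees with leaf weights $P$; this minimum is the Huffman cost. A non-decreasing sequence $P$ of $n$ positive integers is $k$-ordered if $p^{(i)}_2 = p^{(i)}_3$ for $i=0,\dots,k$ and $p^{(i)}_2 < p^{(i)}_3$ for $i=k+1,\dots,n-3$. $M_{n,k}$ denotes the set of all $k$-ordered sequences of size $n$ for which an elongated binary tree of size $n$ is a Huffman tree. A sequence $P_{\min}\in M$ is minimizing for the tree $T$ in a class $M$ if $E(T,P_{\min})\le E(T,P)$ for all $P\in M$. -}

module Defs where

open import Data.Nat using (ℕ; zero; suc; _+_; _*_; _∸_; _^_; _≤_; _<_; _≤?_)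
open import Data.Nat.Properties using (_≤?_)
open import Data.List using (List; []; _∷_; _++_; length; filter; applyUpTo)
open import Data.List.Relation.Unary.All using (All)
open import Data.List.Relation.Unary.Linked using (Linked)
open import Data.List.Relation.Binary.Permutation.Propositional using (_↭_)
open import Relation.Binary.Construct.Closure.ReflexiveTransitive using (Star)
open import Relation.Binary.PropositionalEquality using (_≡_)
open import Data.Product using (_×_; ∃)
open import Data.Sum using (_⊎_)
open import Data.Empty using (⊥)
open import Data.Unit using (⊤)
open import Data.Bool using (if_then_else_)
open import Relation.Nullary.Decidable using (does)
open import Function using (_∘_)

fib : ℕ → ℕ
fib zero = 0
fib (suc zero) = 1
fib (suc (suc i)) = fib (suc i) + fib i

-- ⌊ m φ ⌋ with φ = (1+√5)/2, computed exactly over ℕ: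
-- ⌊ m φ ⌋ is the number of x ∈ {1,…,2m} with x ≤ m φ, and (since φ < 2)
-- x ≤ m φ  ⇔  2x - m ≤ m √5  ⇔  (2x ∸ m)² ≤ 5 m².

floorPhi : ℕ → ℕ
floorPhi m = length (filter (λ x → (2 * x ∸ m) ^ 2 ≤? 5 * m ^ 2) (applyUpTo suc (2 * m)))

wythoff : ℕ → ℕ → ℕ
wythoff i zero = i
wythoff i (suc zero) = floorPhi (suc i)
wythoff i (suc (suc j)) = wythoff i (suc j) + wythoff i j

pmin : ℕ → ℕ → List ℕ
pmin n k = 1 ∷ (applyUpTo (λ i → fib (suc i)) (suc k)
               ++ applyUpTo (wythoff (fib (suc (suc k)))) (n ∸ k ∸ 2))

data Tree : Set where
  leaf : ℕ → Tree
  node : Tree → Tree → Tree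

IsLeaf : Tree → Set
IsLeaf (leaf _) = ⊤
IsLeaf (node _ _) = ⊥

Elongated : Tree → Set
Elongated (leaf _) = ⊤
Elongated (node l r) = (IsLeaf l ⊎ IsLeaf r) × Elongated l × Elongated r

weight : Tree → ℕ
weight (leaf p) = p
weight (node l r) = weight l + weight r

eplFrom : ℕ → Tree → ℕ
eplFrom d (leaf p) = d * p
eplFrom d (node l r) = eplFrom (suc d) l + eplFrom (suc d) r

E : Tree → ℕ
E = eplFrom 0

-- One step: the two first trees are merged, and the result is any
-- ordering of the new forest that is non-decreasing by weight
-- (all possible tie resolutions are allowed).

SortedW : List Tree → Set
SortedW = Linked (λ s t → weight s ≤ weight t)

data HuffStep : List Tree → List Tree → Set where
  merge : ∀ {t₁ t₂ rest out} →
          out ↭ (node t₁ t₂ ∷ rest) → SortedW out →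
          HuffStep (t₁ ∷ t₂ ∷ rest) out

HuffmanTree : List ℕ → Tree → Set
HuffmanTree P T = Star HuffStep (Data.List.map leaf P) (T ∷ [])

-- The weight sequences P^(i) (deterministic: sorting a multiset of
-- numbers is unique).

insert : ℕ → List ℕ → List ℕ
insert x [] = x ∷ []
insert x (y ∷ ys) = if does (x ≤? y) then x ∷ y ∷ ys else y ∷ insert x ys

hstep : List ℕ → List ℕ
hstep (a ∷ b ∷ rest) = insert (a + b) rest
hstep l = l

P^ : ℕ → List ℕ → List ℕ
P^ zero P = P
P^ (suc i) P = hstep (P^ i P)

Eq23 : List ℕ → Set
Eq23 (_ ∷ b ∷ c ∷ _) = b ≡ c
Eq23 _ = ⊥

Lt23 : List ℕ → Set
Lt23 (_ ∷ b ∷ c ∷ _) = b < c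
Lt23 _ = ⊥

KOrdered : ℕ → ℕ → List ℕ → Set
KOrdered n k P =
  (∀ i → i ≤ k → Eq23 (P^ i P)) ×
  (∀ i → suc k ≤ i → i ≤ n ∸ 3 → Lt23 (P^ i P))

InM : ℕ → ℕ → List ℕ → Set
InM n k P =
  length P ≡ n ×
  All (λ p → 1 ≤ p) P ×
  Linked _≤_ P ×
  KOrdered n k P ×
  ∃ (λ T → HuffmanTree P T × Elongated T)

-- In an elongated Huffman tree at most one internal node exists at any time, so on
-- p₁ ≤ ⋯ ≤ pₙ the algorithm keeps merging the running sum sᵢ = p₁ + ⋯ + pᵢ with pᵢ₊₁;
-- this is possible exactly when sᵢ ≤ pᵢ₊₂ for all i (a chain), and then the cost is
-- s₂ + ⋯ + sₙ. After step k, k-ordering puts the third smallest weight strictly above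
-- the second, which sharpens the chain condition to pᵢ₊₂ ≥ sᵢ + 1 for i > k + 1. The cost
-- is monotone in the weights, so it is smallest for p₁ = p₂ = 1 with all these bounds
-- attained. That sequence is itself a k-ordered chain, and it is P_min: Fibonacci numbers,
-- then the same recurrence restarted from F(k+2) and F(k+3) + 1 = ⌊(F(k+2) + 1)φ⌋, a row
-- of the Wythoff array; the floor identity follows from Cassini's identity.

module Submission where

open import Defs
open import Algebra.Properties.CommutativeSemigroup using (interchange)
open import Data.Bool using (true; false; if_then_else_)
open import Data.Empty using (⊥-elim)
open import Data.List using (List; []; _∷_; _++_; length; map; filter; applyUpTo)
open import Data.List.Membership.Propositional using (_∈_)
open import Data.List.Membership.Propositional.Properties using (∈-map⁻)
open import Data.List.Properties using (length-map; filter-accept; filter-reject)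
open import Data.List.Relation.Binary.Equality.Propositional using (≋⇒≡)
open import Data.List.Relation.Binary.Permutation.Propositional
  using (_↭_; prep; swap; ↭-refl; ↭-trans; ↭-sym; ↭⇒↭ₛ)
open import Data.List.Relation.Binary.Permutation.Propositional.Properties
  using (All-resp-↭; ∈-resp-↭; drop-∷; ↭-length)
import Data.List.Relation.Binary.Permutation.Propositional.Properties as Perm
open import Data.List.Relation.Unary.All using (All; []; _∷_)
open import Data.List.Relation.Unary.Any using (here; there)
open import Data.List.Relation.Unary.Linked using (Linked; []; [-]; _∷_)
import Data.List.Relation.Unary.Linked as Linked
import Data.List.Relation.Unary.Linked.Properties as Linked
open import Data.List.Relation.Unary.Linked.Properties using (Linked⇒All)
open import Data.List.Relation.Unary.Sorted.TotalOrder.Properties using (↗↭↗⇒≋)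
open import Data.Nat using (ℕ; zero; suc; _+_; _*_; _∸_; _^_; _≤_; _<_; _⊓_; _⊔_; _≤ᵇ_; z≤n; s≤s)
open import Data.Nat.ListAction using (sum)
open import Data.Nat.ListAction.Properties using (sum-↭)
open import Data.Nat.Properties
open import Data.Nat.Tactic.RingSolver using (solve-∀)
import Data.List.Sort.InsertionSort.Base ≤-decTotalOrder as InsertionSort
import Data.List.Sort.InsertionSort.Properties ≤-decTotalOrder as InsertionSortProperties
open import Data.Product using (_×_; _,_; proj₁; proj₂; ∃-syntax)
open import Data.Sum using (_⊎_; inj₁; inj₂)
open import Data.Unit using (⊤; tt)
open import Function using (_∘_)
open import Relation.Binary.Construct.Closure.ReflexiveTransitive using (Star; ε; _◅_)
open import Relation.Binary.PropositionalEquality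
open import Relation.Nullary using (¬_; yes; no)
open import Relation.Unary using (Decidable)
open import Relation.Nullary.Decidable using (dec-true; dec-false)

Sorted : List ℕ → Set
Sorted = Linked _≤_

infix 4 _≤head_

_≤head_ : ℕ → List ℕ → Set
s ≤head [] = ⊤
s ≤head (e ∷ _) = s ≤ e

sorted⇒≤head : ∀ {x xs} → Sorted (x ∷ xs) → x ≤head xs
sorted⇒≤head [-] = tt
sorted⇒≤head (x≤y ∷ _) = x≤y

sorted-skip : ∀ {x y xs} → Sorted (x ∷ y ∷ xs) → Sorted (x ∷ xs)
sorted-skip {xs = []} _ = [-]
sorted-skip {xs = _ ∷ _} (x≤y ∷ y≤z ∷ zs↗) = ≤-trans x≤y y≤z ∷ zs↗

≤-≤head-trans : ∀ {x y} D → x ≤ y → y ≤head D → x ≤head D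
≤-≤head-trans [] _ _ = tt
≤-≤head-trans (_ ∷ _) x≤y y≤e = ≤-trans x≤y y≤e

all⇒≤head : ∀ {x D} → All (x ≤_) D → x ≤head D
all⇒≤head [] = tt
all⇒≤head (x≤d ∷ _) = x≤d

sorted-↭-unique : ∀ {xs ys} → Sorted xs → Sorted ys → xs ↭ ys → xs ≡ ys
sorted-↭-unique xs↗ ys↗ xs↭ys = ≋⇒≡ (↗↭↗⇒≋ ≤-totalOrder xs↗ ys↗ (↭⇒↭ₛ xs↭ys))

m⊓n+m⊔n≡m+n : ∀ m n → m ⊓ n + (m ⊔ n) ≡ m + n
m⊓n+m⊔n≡m+n m n with ≤-total m n
... | inj₁ m≤n = cong₂ _+_ (m≤n⇒m⊓n≡m m≤n) (m≤n⇒m⊔n≡n m≤n)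
... | inj₂ n≤m = trans (cong₂ _+_ (m≥n⇒m⊓n≡n n≤m) (m≥n⇒m⊔n≡m n≤m)) (+-comm n m)

insert-≗ : ∀ x xs → insert x xs ≡ InsertionSort.insert x xs
insert-≗ x [] = refl
insert-≗ x (y ∷ ys) = cong (λ zs → if x ≤ᵇ y then x ∷ y ∷ ys else y ∷ zs) (insert-≗ x ys)

insert-↭ : ∀ x xs → insert x xs ↭ x ∷ xs
insert-↭ x xs = subst (_↭ x ∷ xs) (sym (insert-≗ x xs)) (InsertionSortProperties.insert-↭ x xs)

insert-↗ : ∀ x {xs} → Sorted xs → Sorted (insert x xs)
insert-↗ x {xs} xs↗ = subst Sorted (sym (insert-≗ x xs)) (InsertionSortProperties.insert-↗ x xs↗)

insert-≤head : ∀ {x} xs → x ≤head xs → insert x xs ≡ x ∷ xs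
insert-≤head [] _ = refl
insert-≤head {x} (y ∷ ys) x≤y =
  cong (λ b → if b then x ∷ y ∷ ys else y ∷ insert x ys) (dec-true (x ≤? y) x≤y)

insert-≰ : ∀ {x y} ys → ¬ x ≤ y → insert x (y ∷ ys) ≡ y ∷ insert x ys
insert-≰ {x} {y} ys x≰y =
  cong (λ b → if b then x ∷ y ∷ ys else y ∷ insert x ys) (dec-false (x ≤? y) x≰y)

insert-merge : ∀ s d D → s ≤head D → insert s (d ∷ D) ≡ s ⊓ d ∷ s ⊔ d ∷ D
insert-merge s d D s≤D with s ≤? d
... | yes s≤d rewrite insert-≤head (d ∷ D) s≤d | m≤n⇒m⊓n≡m s≤d | m≤n⇒m⊔n≡n s≤d = refl
... | no s≰d rewrite insert-≰ D s≰d | insert-≤head D s≤D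
                   | m≥n⇒m⊓n≡n (≰⇒≥ s≰d) | m≥n⇒m⊔n≡m (≰⇒≥ s≰d) = refl

hstep-insert-merge : ∀ s d D → s ≤head D → hstep (insert s (d ∷ D)) ≡ insert (s + d) D
hstep-insert-merge s d D s≤D rewrite insert-merge s d D s≤D | m⊓n+m⊔n≡m+n s d = refl

-- The cost of a Huffman run

weights : List Tree → List ℕ
weights = map weight

weights-leaves : ∀ P → weights (map leaf P) ≡ P
weights-leaves [] = refl
weights-leaves (p ∷ P) = cong (p ∷_) (weights-leaves P)

forestCost : List Tree → ℕ
forestCost F = sum (map E F)

forestCost-leaves : ∀ P → forestCost (map leaf P) ≡ 0
forestCost-leaves [] = refl
forestCost-leaves (_ ∷ P) = forestCost-leaves P

mergeCost : ℕ → List ℕ → ℕ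
mergeCost (suc f) (a ∷ b ∷ P) = a + b + mergeCost f (insert (a + b) P)
mergeCost _ _ = 0

eplFrom-suc : ∀ d t → eplFrom (suc d) t ≡ eplFrom d t + weight t
eplFrom-suc d (leaf p) = +-comm p (d * p)
eplFrom-suc d (node l r) = begin
  eplFrom (2 + d) l + eplFrom (2 + d) r
    ≡⟨ cong₂ _+_ (eplFrom-suc (suc d) l) (eplFrom-suc (suc d) r) ⟩
  (eplFrom (suc d) l + weight l) + (eplFrom (suc d) r + weight r)
    ≡⟨ interchange +-commutativeSemigroup
                   (eplFrom (suc d) l) (weight l) (eplFrom (suc d) r) (weight r) ⟩
  eplFrom d (node l r) + weight (node l r) ∎
  where open ≡-Reasoning

E-node : ∀ l r → E (node l r) ≡ E l + E r + (weight l + weight r)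
E-node l r = trans (cong₂ _+_ (eplFrom-suc 0 l) (eplFrom-suc 0 r))
                   (interchange +-commutativeSemigroup (E l) (weight l) (E r) (weight r))

step-weights : ∀ {t₁ t₂ rest F′} → HuffStep (t₁ ∷ t₂ ∷ rest) F′ →
               Sorted (weights (t₁ ∷ t₂ ∷ rest)) →
               weights F′ ≡ insert (weight t₁ + weight t₂) (weights rest)
step-weights (merge F′↭ F′↗) F↗ =
  sorted-↭-unique (Linked.map⁺ F′↗) (insert-↗ _ (Linked.tail (Linked.tail F↗)))
                  (↭-trans (Perm.map⁺ weight F′↭) (↭-sym (insert-↭ _ _)))

run-cost : ∀ {F T} → Star HuffStep F (T ∷ []) → Sorted (weights F) →
           E T ≡ forestCost F + mergeCost (length F) (weights F)
run-cost ε _ = sym (trans (+-identityʳ _) (+-identityʳ _))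
run-cost {T = T} (step@(merge {t₁} {t₂} {rest} {F′} F′↭ F′↗) ◅ run) F↗ = begin
  E T
    ≡⟨ run-cost run (Linked.map⁺ F′↗) ⟩
  forestCost F′ + mergeCost (length F′) (weights F′)
    ≡⟨ cong₂ _+_ (sum-↭ (Perm.map⁺ E F′↭))
                 (cong₂ mergeCost (↭-length F′↭) (step-weights step F↗)) ⟩
  (E (node t₁ t₂) + forestCost rest) + m
    ≡⟨ cong (λ x → x + forestCost rest + m) (E-node t₁ t₂) ⟩
  (E t₁ + E t₂ + w + forestCost rest) + m
    ≡⟨ regroup (E t₁) (E t₂) w (forestCost rest) m ⟩
  (E t₁ + (E t₂ + forestCost rest)) + (w + m) ∎
  where
  open ≡-Reasoning
  w = weight t₁ + weight t₂
  m = mergeCost (suc (length rest)) (insert w (weights rest))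
  regroup : ∀ a b c d e → (a + b + c + d) + e ≡ (a + (b + d)) + (c + e)
  regroup = solve-∀

huffman-cost : ∀ {P T} → Sorted P → HuffmanTree P T → E T ≡ mergeCost (length P) P
huffman-cost {P} {T} P↗ run = begin
  E T
    ≡⟨ run-cost run (subst Sorted (sym (weights-leaves P)) P↗) ⟩
  forestCost (map leaf P) + mergeCost (length (map leaf P)) (weights (map leaf P))
    ≡⟨ cong₂ _+_ (forestCost-leaves P) (cong₂ mergeCost (length-map leaf P) (weights-leaves P)) ⟩
  mergeCost (length P) P ∎
  where open ≡-Reasoning

Chain : ℕ → List ℕ → Set
Chain s [] = ⊤
Chain s (d ∷ D) = s ≤head D × Chain (s + d) D

chainCost : ℕ → List ℕ → ℕ
chainCost s [] = 0
chainCost s (d ∷ D) = s + d + chainCost (s + d) D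

mergeCost-chain : ∀ s D → Chain s D → mergeCost (suc (length D)) (insert s D) ≡ chainCost s D
mergeCost-chain s [] _ = refl
mergeCost-chain s (d ∷ D) (s≤D , chain)
  rewrite insert-merge s d D s≤D | m⊓n+m⊔n≡m+n s d =
  cong (s + d +_) (mergeCost-chain (s + d) D chain)

chain-cost : ∀ {p D T} → Sorted (p ∷ D) → Chain p D → HuffmanTree (p ∷ D) T → E T ≡ chainCost p D
chain-cost {p} {D} {T} pD↗ chain run = begin
  E T               ≡⟨ huffman-cost pD↗ run ⟩
  cost (p ∷ D)      ≡⟨ cong cost (insert-≤head D (sorted⇒≤head pD↗)) ⟨
  cost (insert p D) ≡⟨ mergeCost-chain p D chain ⟩
  chainCost p D     ∎
  where
  open ≡-Reasoning
  cost = mergeCost (suc (length D))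

-- Elongated Huffman trees and chains

isNode : Tree → ℕ
isNode (leaf _) = 0
isNode (node _ _) = 1

nodeCount : List Tree → ℕ
nodeCount F = sum (map isNode F)

nodeCount-↭ : ∀ {F G} → F ↭ G → nodeCount F ≡ nodeCount G
nodeCount-↭ F↭G = sum-↭ (Perm.map⁺ isNode F↭G)

isNode≤1 : ∀ t → isNode t ≤ 1
isNode≤1 (leaf _) = z≤n
isNode≤1 (node _ _) = ≤-refl

siblings-isNode : ∀ t₁ t₂ → IsLeaf t₁ ⊎ IsLeaf t₂ → isNode t₁ + isNode t₂ ≤ 1
siblings-isNode (leaf _) t₂ _ = isNode≤1 t₂
siblings-isNode (node _ _) (leaf _) _ = ≤-refl
siblings-isNode (node _ _) (node _ _) (inj₁ ())
siblings-isNode (node _ _) (node _ _) (inj₂ ())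

elongated-run-forests : ∀ {F T} → Star HuffStep F (T ∷ []) → Elongated T →
                        All Elongated F × nodeCount F ≤ 1
elongated-run-forests {T = T} ε eT =
  eT ∷ [] , subst (_≤ 1) (sym (+-identityʳ (isNode T))) (isNode≤1 T)
elongated-run-forests (merge {t₁} {t₂} {rest} F′↭ _ ◅ run) eT with elongated-run-forests run eT
... | F′-elongated , F′≤1 with All-resp-↭ F′↭ F′-elongated | subst (_≤ 1) (nodeCount-↭ F′↭) F′≤1
... | (siblings , e₁ , e₂) ∷ rest-elongated | s≤s rest≤0 =
  e₁ ∷ e₂ ∷ rest-elongated ,
  subst (_≤ 1) (+-assoc (isNode t₁) _ _) (+-mono-≤ (siblings-isNode t₁ t₂ siblings) rest≤0)

nodeCount≡0⇒leaves : ∀ F → nodeCount F ≡ 0 → F ≡ map leaf (weights F)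
nodeCount≡0⇒leaves [] _ = refl
nodeCount≡0⇒leaves (leaf p ∷ F) F≡0 = cong (leaf p ∷_) (nodeCount≡0⇒leaves F F≡0)

merged-rest-leaves : ∀ {F′ T t₁ t₂ rest} → Star HuffStep F′ (T ∷ []) → Elongated T →
                     F′ ↭ node t₁ t₂ ∷ rest → rest ≡ map leaf (weights rest)
merged-rest-leaves {rest = rest} run eT F′↭
  with subst (_≤ 1) (nodeCount-↭ F′↭) (proj₂ (elongated-run-forests run eT))
... | s≤s rest≤0 = nodeCount≡0⇒leaves rest (n≤0⇒n≡0 rest≤0)

node∉leaves : ∀ {l r} P → ¬ node l r ∈ map leaf P
node∉leaves P node∈ with ∈-map⁻ leaf node∈
... | _ , _ , ()

weights-↭-leaves : ∀ {F P} → F ↭ map leaf P → Sorted (weights F) → Sorted P → weights F ≡ P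
weights-↭-leaves {F} {P} F↭ F↗ P↗ =
  sorted-↭-unique F↗ P↗ (subst (weights F ↭_) (weights-leaves P) (Perm.map⁺ weight F↭))

merged-with-node : ∀ {l r t₁ t₂ rest d D} → t₁ ∷ t₂ ∷ rest ↭ node l r ∷ map leaf (d ∷ D) →
                   Sorted (weights (t₁ ∷ t₂ ∷ rest)) → Sorted (d ∷ D) →
                   rest ≡ map leaf (weights rest) →
                   rest ≡ map leaf D × weight t₁ + weight t₂ ≡ weight l + weight r + d ×
                   weight l + weight r ≤head D
merged-with-node {l} {r} {t₁} {t₂} {rest} F↭ F↗ dD↗ rest-leaves
  with ∈-resp-↭ (↭-sym F↭) (here refl)
... | here refl with weights-↭-leaves (drop-∷ F↭) (Linked.tail F↗) dD↗
...   | refl = rest-leaves , refl , sorted⇒≤head (sorted-skip F↗)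
merged-with-node {l} {r} {t₁} {t₂} {rest} F↭ F↗ dD↗ rest-leaves | there (here refl)
  with weights-↭-leaves (drop-∷ (↭-trans (swap (node l r) t₁ ↭-refl) F↭)) (sorted-skip F↗) dD↗
...   | refl =
  rest-leaves , +-comm (weight t₁) (weight l + weight r) , sorted⇒≤head (Linked.tail F↗)
merged-with-node {rest = rest} F↭ F↗ dD↗ rest-leaves | there (there node∈rest) =
  ⊥-elim (node∉leaves (weights rest) (subst (_ ∈_) rest-leaves node∈rest))

elongated-run⇒chain : ∀ {F T} l r D → F ↭ node l r ∷ map leaf D → Sorted (weights F) → Sorted D →
                      Star HuffStep F (T ∷ []) → Elongated T → Chain (weight l + weight r) D
elongated-run⇒chain l r [] _ _ _ _ _ = tt
elongated-run⇒chain l r (d ∷ D) F↭ _ _ ε _ with ↭-length F↭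
... | ()
elongated-run⇒chain l r (d ∷ D) F↭ F↗ dD↗ (merge {t₁} {t₂} F′↭ F′↗ ◅ run) eT
  with merged-with-node F↭ F↗ dD↗ (merged-rest-leaves run eT F′↭)
... | refl , merged≡ , l+r≤D =
  l+r≤D ,
  subst (λ s → Chain s D) merged≡
    (elongated-run⇒chain t₁ t₂ D F′↭ (Linked.map⁺ F′↗) (Linked.tail dD↗) run eT)

elongated⇒chain : ∀ {p D T} → Sorted (p ∷ D) → HuffmanTree (p ∷ D) T → Elongated T → Chain p D
elongated⇒chain {D = []} _ _ _ = tt
elongated⇒chain {p} {q ∷ D} P↗ (merge F′↭ F′↗ ◅ run) eT =
  sorted⇒≤head (sorted-skip P↗) ,
  elongated-run⇒chain (leaf p) (leaf q) D F′↭ (Linked.map⁺ F′↗) (Linked.tail (Linked.tail P↗))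
                      run eT

insertTree : Tree → List Tree → List Tree
insertTree c [] = c ∷ []
insertTree c (t ∷ F) = if weight c ≤ᵇ weight t then c ∷ t ∷ F else t ∷ insertTree c F

weights-insertTree : ∀ c F → weights (insertTree c F) ≡ insert (weight c) (weights F)
weights-insertTree c [] = refl
weights-insertTree c (t ∷ F) with weight c ≤ᵇ weight t
... | true = refl
... | false = cong (weight t ∷_) (weights-insertTree c F)

insertTree-↭ : ∀ c F → insertTree c F ↭ c ∷ F
insertTree-↭ c [] = ↭-refl
insertTree-↭ c (t ∷ F) with weight c ≤ᵇ weight t
... | true = ↭-refl
... | false = ↭-trans (prep t (insertTree-↭ c F)) (swap t c ↭-refl)

insertTree-leaves : ∀ c D → weight c ≤head D → insertTree c (map leaf D) ≡ c ∷ map leaf D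
insertTree-leaves c [] _ = refl
insertTree-leaves c (d ∷ D) c≤d =
  cong (λ b → if b then c ∷ leaf d ∷ map leaf D else leaf d ∷ insertTree c (map leaf D))
       (dec-true (weight c ≤? d) c≤d)

merge-into-leaves : ∀ x y D → Sorted D →
                    HuffStep (x ∷ y ∷ map leaf D) (insertTree (node x y) (map leaf D))
merge-into-leaves x y D D↗ =
  merge (insertTree-↭ (node x y) (map leaf D))
        (Linked.map⁻ (subst Sorted (sym (weights-insertTree (node x y) (map leaf D)))
                            (insert-↗ _ (subst Sorted (sym (weights-leaves D)) D↗))))

chain⇒elongated-run-forests : ∀ c D → Elongated c → Sorted D → Chain (weight c) D →
                      ∃[ T ] Star HuffStep (insertTree c (map leaf D)) (T ∷ []) × Elongated T
chain⇒elongated-run-forests c [] ec _ _ = c , ε , ec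
chain⇒elongated-run-forests c (d ∷ D) ec dD↗ (c≤D , chain) with weight c ≤ᵇ d
... | true =
  let T , run , eT = chain⇒elongated-run-forests (node c (leaf d)) D (inj₂ tt , ec , tt) D↗ chain
  in T , merge-into-leaves c (leaf d) D D↗ ◅ run , eT
  where D↗ = Linked.tail dD↗
... | false rewrite insertTree-leaves c D c≤D =
  let T , run , eT = chain⇒elongated-run-forests (node (leaf d) c) D (inj₁ tt , tt , ec) D↗
                       (subst (λ s → Chain s D) (+-comm (weight c) d) chain)
  in T , merge-into-leaves (leaf d) c D D↗ ◅ run , eT
  where D↗ = Linked.tail dD↗

chain⇒elongated : ∀ {p D} → Sorted (p ∷ D) → Chain p D → ∃[ T ] HuffmanTree (p ∷ D) T × Elongated T
chain⇒elongated {p} {D} pD↗ chain =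
  subst (λ F → ∃[ T ] Star HuffStep F (T ∷ []) × Elongated T)
        (insertTree-leaves (leaf p) D (sorted⇒≤head pD↗))
        (chain⇒elongated-run-forests (leaf p) D tt (Linked.tail pD↗) chain)

-- k-ordered chains

gap : ℕ → ℕ → ℕ
gap k zero = 0
gap zero (suc i) = 1
gap (suc k) (suc i) = gap k i

gap-≤ : ∀ {k i} → i ≤ k → gap k i ≡ 0
gap-≤ {k} {zero} _ = refl
gap-≤ {suc k} {suc i} (s≤s i≤k) = gap-≤ i≤k

gap-> : ∀ {k i} → k < i → gap k i ≡ 1
gap-> {zero} {suc i} _ = refl
gap-> {suc k} {suc i} (s≤s k<i) = gap-> k<i

gap≤1 : ∀ k i → gap k i ≤ 1
gap≤1 k zero = z≤n
gap≤1 zero (suc i) = ≤-refl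
gap≤1 (suc k) (suc i) = gap≤1 k i

OrderedState : ℕ → ℕ → List ℕ → Set
OrderedState k i Q = (i ≤ k → Eq23 Q) × (k < i → Lt23 Q)

GapBound : ℕ → ℕ → ℕ → List ℕ → Set
GapBound k i s [] = ⊤
GapBound k i s (d ∷ D) = s + gap k i ≤head D × GapBound k (suc i) (s + d) D

Lt23⇒gap-≤ : ∀ {k i s d e E} → s ≤ e → (k < i → Lt23 (insert s (d ∷ e ∷ E))) → s + gap k i ≤ e
Lt23⇒gap-≤ {k} {i} {s} {d} {e} {E} s≤e lt with i ≤? k
... | yes i≤k = subst (_≤ e) (sym (trans (cong (s +_) (gap-≤ i≤k)) (+-identityʳ s))) s≤e
... | no i≰k with lt (≰⇒> i≰k)
...   | s⊔d<e rewrite insert-merge s d (e ∷ E) s≤e | gap-> (≰⇒> i≰k) | +-comm s 1 =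
  ≤-<-trans (m≤m⊔n s d) s⊔d<e

kOrdered⇒gapBound : ∀ {k X m} i s D → Chain s D → P^ i X ≡ insert s D → i + length D ≡ m →
                    (∀ j → k < j → j + 2 ≤ m → Lt23 (P^ j X)) → GapBound k i s D
kOrdered⇒gapBound i s [] _ _ _ _ = tt
kOrdered⇒gapBound i s (d ∷ []) _ _ _ _ = tt , tt
kOrdered⇒gapBound {k} {X} i s (d ∷ e ∷ E) (s≤e , chain) state i+|D|≡m lt =
  Lt23⇒gap-≤ s≤e (λ k<i → subst Lt23 state (lt i k<i i+2≤m)) ,
  kOrdered⇒gapBound (suc i) (s + d) (e ∷ E) chain
    (trans (cong hstep state) (hstep-insert-merge s d (e ∷ E) s≤e))
    (trans (sym (+-suc i _)) i+|D|≡m) lt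
  where
  i+2≤m = subst (i + 2 ≤_) i+|D|≡m (+-monoʳ-≤ i (s≤s (s≤s z≤n)))

-- Every bound of GapBound holds with equality along minChain.
minChain : ℕ → ℕ → ℕ → ℕ → ℕ → List ℕ
minChain k i s d zero = []
minChain k i s d (suc m) = d ∷ minChain k (suc i) (s + d) (s + gap k i) m

length-minChain : ∀ k i s d m → length (minChain k i s d m) ≡ m
length-minChain k i s d zero = refl
length-minChain k i s d (suc m) = cong suc (length-minChain k (suc i) (s + d) (s + gap k i) m)

minChain-chain : ∀ k i s d m → Chain s (minChain k i s d m)
minChain-chain k i s d zero = tt
minChain-chain k i s d (suc zero) = tt , tt
minChain-chain k i s d (suc (suc m)) =
  m≤m+n s (gap k i) , minChain-chain k (suc i) (s + d) (s + gap k i) (suc m)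

minChain-bounds-step : ∀ k i {s d} → 1 ≤ d → d ≤ s → 1 ≤ s + gap k i × s + gap k i ≤ s + d
minChain-bounds-step k i {s} 1≤d d≤s =
  ≤-trans (≤-trans 1≤d d≤s) (m≤m+n s (gap k i)) , +-monoʳ-≤ s (≤-trans (gap≤1 k i) 1≤d)

minChain-↗ : ∀ k i {s d} m → 1 ≤ d → d ≤ s → Sorted (minChain k i s d m)
minChain-↗ k i zero _ _ = []
minChain-↗ k i (suc zero) _ _ = [-]
minChain-↗ k i {s} (suc (suc m)) 1≤d d≤s =
  let 1≤d′ , d′≤s′ = minChain-bounds-step k i 1≤d d≤s
  in ≤-trans d≤s (m≤m+n s (gap k i)) ∷ minChain-↗ k (suc i) (suc m) 1≤d′ d′≤s′

minChain-orderedState : ∀ k i {s d} m → d ≤ s →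
                        OrderedState k i (insert s (minChain k i s d (2 + m)))
minChain-orderedState k i {s} {d} m d≤s
  rewrite insert-merge s d (minChain k (suc i) (s + d) (s + gap k i) (suc m)) (m≤m+n s (gap k i))
        | m≥n⇒m⊔n≡m d≤s =
  (λ i≤k → sym (trans (cong (s +_) (gap-≤ i≤k)) (+-identityʳ s))) ,
  (λ k<i → subst (s <_) (sym (trans (cong (s +_) (gap-> k<i)) (+-comm s 1))) ≤-refl)

minChain-kOrdered : ∀ {k X} i {s d} m → 1 ≤ d → d ≤ s → P^ i X ≡ insert s (minChain k i s d m) →
                    ∀ t → 2 + t ≤ m → OrderedState k (i + t) (P^ (i + t) X)
minChain-kOrdered i (suc zero) _ _ _ zero (s≤s ())
minChain-kOrdered {k} {X} i (suc (suc m)) _ d≤s state zero _ =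
  subst (λ j → OrderedState k j (P^ j X)) (sym (+-identityʳ i))
        (subst (OrderedState k i) (sym state) (minChain-orderedState k i m d≤s))
minChain-kOrdered {k} {X} i {s} {d} (suc (suc m)) 1≤d d≤s state (suc t) (s≤s 2+t≤m) =
  let 1≤d′ , d′≤s′ = minChain-bounds-step k i 1≤d d≤s
      state′ = trans (cong hstep state) (hstep-insert-merge s d _ (m≤m+n s (gap k i)))
  in subst (λ j → OrderedState k j (P^ j X)) (sym (+-suc i t))
           (minChain-kOrdered (suc i) (suc m) 1≤d′ d′≤s′ state′ t 2+t≤m)

minChain-minimal : ∀ {k i s d s′} D → s ≤ s′ → d ≤head D → GapBound k i s′ D →
                   chainCost s (minChain k i s d (length D)) ≤ chainCost s′ D
minChain-minimal [] _ _ _ = z≤n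
minChain-minimal {k} {i} {s} (e ∷ E) s≤s′ d≤e (s′+gap≤E , bound) =
  +-mono-≤ s+d≤s′+e
    (minChain-minimal E s+d≤s′+e (≤-≤head-trans E (+-monoˡ-≤ (gap k i) s≤s′) s′+gap≤E) bound)
  where s+d≤s′+e = +-mono-≤ s≤s′ d≤e

minSequence : ℕ → ℕ → List ℕ
minSequence k L = 1 ∷ minChain k 0 1 1 L

Minimizing : ℕ → ℕ → List ℕ → Set
Minimizing n k Q =
  InM n k Q ×
  (∀ (P : List ℕ) → InM n k P → ∀ (T T′ : Tree) → HuffmanTree Q T → HuffmanTree P T′ → E T ≤ E T′)

minSequence-↗ : ∀ k L → Sorted (minSequence k L)
minSequence-↗ k zero = [-]
minSequence-↗ k (suc L) = ≤-refl ∷ minChain-↗ k 0 (suc L) ≤-refl ≤-refl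

minSequence-∈M : ∀ k L → 2 ≤ L → k ≤ L ∸ 2 → InM (suc L) k (minSequence k L)
minSequence-∈M k L 2≤L k≤L∸2 =
  cong suc (length-minChain k 0 1 1 L) ,
  Linked⇒All ≤-trans ≤-refl (minSequence-↗ k L) ,
  minSequence-↗ k L ,
  ((λ i i≤k → proj₁ (ordered i (≤-trans i≤k k≤L∸2)) i≤k) ,
   (λ i k<i i≤L∸2 → proj₂ (ordered i i≤L∸2) k<i)) ,
  chain⇒elongated (minSequence-↗ k L) (minChain-chain k 0 1 1 L)
  where
  ordered : ∀ i → i ≤ L ∸ 2 → OrderedState k i (P^ i (minSequence k L))
  ordered i i≤L∸2 =
    minChain-kOrdered 0 L ≤-refl ≤-refl
      (sym (insert-≤head (minChain k 0 1 1 L) (sorted⇒≤head (minSequence-↗ k L))))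
      i (subst (_≤ L) (+-comm i 2) (m≤o∸n⇒m+n≤o i 2≤L i≤L∸2))

minSequence-minimal : ∀ k L (P : List ℕ) → InM (suc L) k P →
                      ∀ (T T′ : Tree) → HuffmanTree (minSequence k L) T → HuffmanTree P T′ →
                      E T ≤ E T′
minSequence-minimal k L (p ∷ D) (|P|≡ , (1≤p ∷ 1≤D) , P↗ , (_ , lt) , _ , run₀ , eT₀)
                    T T′ run run′ =
  begin
    E T                                        ≡⟨ chain-cost (minSequence-↗ k L) chain₁ run ⟩
    chainCost 1 (minChain k 0 1 1 L)           ≡⟨ cong (chainCost 1 ∘ minChain k 0 1 1) |D|≡L ⟨
    chainCost 1 (minChain k 0 1 1 (length D))  ≤⟨ minChain-minimal D 1≤p (all⇒≤head 1≤D) bound ⟩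
    chainCost p D                              ≡⟨ chain-cost P↗ chain run′ ⟨
    E T′                                       ∎
  where
  open ≤-Reasoning
  |D|≡L = suc-injective |P|≡
  chain₁ = minChain-chain k 0 1 1 L
  chain = elongated⇒chain P↗ run₀ eT₀
  bound = kOrdered⇒gapBound 0 p D chain (sym (insert-≤head D (sorted⇒≤head P↗))) |D|≡L
            (λ j k<j j+2≤L → lt j k<j (m+n≤o⇒m≤o∸n j j+2≤L))

-- Fibonacci numbers and the Wythoff array

Cassini : ℕ → ℕ → Set
Cassini u v = u * u + 1 ≡ u * v + v * v ⊎ u * u ≡ u * v + v * v + 1

cassini-step : ∀ u v → Cassini u v → Cassini (u + v) u
cassini-step u v (inj₁ eq) =
  inj₂ (+-cancelʳ-≡ _ _ _ (trans (expand u v) (cong ((u + v) * u + u * u + 1 +_) (sym eq))))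
  where
  expand : ∀ u v → (u + v) * (u + v) + (u * u + 1) ≡ (u + v) * u + u * u + 1 + (u * v + v * v)
  expand = solve-∀
cassini-step u v (inj₂ eq) =
  inj₁ (+-cancelʳ-≡ _ _ _ (trans (expand u v) (cong ((u + v) * u + u * u +_) (sym eq))))
  where
  expand : ∀ u v → (u + v) * (u + v) + 1 + u * u ≡ (u + v) * u + u * u + (u * v + v * v + 1)
  expand = solve-∀

cassini : ∀ k → Cassini (fib (2 + k)) (fib (1 + k))
cassini zero = inj₁ refl
cassini (suc k) = cassini-step (fib (2 + k)) (fib (1 + k)) (cassini k)

m^2≡m*m : ∀ m → m ^ 2 ≡ m * m
m^2≡m*m m = cong (m *_) (*-identityʳ m)

cassini-square-bounds : ∀ u v → Cassini u v →
  (u + 2 * v) * (u + 2 * v) ≤ 5 * (u * u) + 4 × 5 * (u * u) ≤ (u + 2 * v) * (u + 2 * v) + 4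
cassini-square-bounds u v (inj₁ eq) =
  ≤-reflexive a²≡ , ≤-trans (m≤m+n _ 4) (≤-trans (≤-reflexive (sym a²≡)) (m≤m+n _ 4))
  where
  expand : ∀ u v → (u + 2 * v) * (u + 2 * v) ≡ u * u + 4 * (u * v + v * v)
  expand = solve-∀
  collect : ∀ u → u * u + 4 * (u * u + 1) ≡ 5 * (u * u) + 4
  collect = solve-∀
  a²≡ = trans (expand u v) (trans (cong (λ x → u * u + 4 * x) (sym eq)) (collect u))
cassini-square-bounds u v (inj₂ eq) =
  ≤-trans (m≤m+n _ 4) (≤-trans (≤-reflexive a²+4≡) (m≤m+n _ 4)) , ≤-reflexive (sym a²+4≡)
  where
  expand : ∀ u v → (u + 2 * v) * (u + 2 * v) + 4 ≡ u * u + 4 * (u * v + v * v + 1)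
  expand = solve-∀
  collect : ∀ u → u * u + 4 * (u * u) ≡ 5 * (u * u)
  collect = solve-∀
  a²+4≡ = trans (expand u v) (trans (cong (λ x → u * u + 4 * x) (sym eq)) (collect u))

length-filter-applyUpTo : ∀ {Q : ℕ → Set} (Q? : Decidable Q) f N c → c ≤ N →
                          (∀ t → t < c → Q (f t)) → (∀ t → c ≤ t → ¬ Q (f t)) →
                          length (filter Q? (applyUpTo f N)) ≡ c
length-filter-applyUpTo Q? f zero zero _ _ _ = refl
length-filter-applyUpTo Q? f (suc N) zero _ _ fails
  rewrite filter-reject Q? {xs = applyUpTo (f ∘ suc) N} (fails 0 z≤n) =
  length-filter-applyUpTo Q? (f ∘ suc) N zero z≤n (λ _ ()) (λ t _ → fails (suc t) z≤n)
length-filter-applyUpTo Q? f (suc N) (suc c) (s≤s c≤N) holds fails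
  rewrite filter-accept Q? {xs = applyUpTo (f ∘ suc) N} (holds 0 (s≤s z≤n)) =
  cong suc (length-filter-applyUpTo Q? (f ∘ suc) N c c≤N (λ t t<c → holds (suc t) (s≤s t<c))
                                                       (λ t c≤t → fails (suc t) (s≤s c≤t)))

floorPhi-unique : ∀ m c → c ≤ 2 * m →
                  (2 * c ∸ m) ^ 2 ≤ 5 * m ^ 2 → 5 * m ^ 2 < (2 * suc c ∸ m) ^ 2 → floorPhi m ≡ c
floorPhi-unique m c c≤2m below above =
  length-filter-applyUpTo (λ x → (2 * x ∸ m) ^ 2 ≤? 5 * m ^ 2) suc (2 * m) c c≤2m
    (λ t t<c → ≤-trans (mono t<c) below)
    (λ t c≤t → <⇒≱ (<-≤-trans above (mono (s≤s c≤t))))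
  where
  mono : ∀ {x y} → x ≤ y → (2 * x ∸ m) ^ 2 ≤ (2 * y ∸ m) ^ 2
  mono x≤y = ^-monoˡ-≤ 2 (∸-monoˡ-≤ m (*-monoʳ-≤ 2 x≤y))

-- With a = u + 2v, Cassini gives |a² − 5u²| = 4, hence a + 1 ≤ (u + 1)√5 < a + 3.
floorPhi-cassini : ∀ v w → 1 ≤ v → w ≤ v → Cassini (v + w) v →
                   floorPhi (suc (v + w)) ≡ suc (v + w + v)
floorPhi-cassini v w 1≤v w≤v cas = floorPhi-unique (suc u) (suc (u + v)) c≤2m below above
  where
  open ≤-Reasoning
  u = v + w
  a = u + 2 * v
  bounds = cassini-square-bounds u v cas

  c≤2m : suc (u + v) ≤ 2 * suc u
  c≤2m = subst (suc (u + v) ≤_) (sym (identity v w)) (m≤m+n (suc (u + v)) (suc w))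
    where
    identity : ∀ v w → 2 * suc (v + w) ≡ suc (v + w + v) + suc w
    identity = solve-∀

  shift : ∀ j → 2 * (j + suc (u + v)) ∸ suc u ≡ a + suc (2 * j)
  shift j = trans (cong (_∸ suc u) (identity j u v)) (m+n∸n≡m (a + suc (2 * j)) (suc u))
    where
    identity : ∀ j u v → 2 * (j + suc (u + v)) ≡ (u + 2 * v + suc (2 * j)) + suc u
    identity = solve-∀

  below : (2 * suc (u + v) ∸ suc u) ^ 2 ≤ 5 * suc u ^ 2
  below = begin
    (2 * suc (u + v) ∸ suc u) ^ 2       ≡⟨ trans (cong (_^ 2) (shift 0)) (m^2≡m*m (a + 1)) ⟩
    (a + 1) * (a + 1)                   ≡⟨ square a ⟩
    a * a + (2 * a + 1)                 ≤⟨ +-mono-≤ (proj₁ bounds) 2a≤10u ⟩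
    5 * (u * u) + 4 + (10 * u + 1)      ≡⟨ collect u ⟩
    5 * (suc u * suc u)                 ≡⟨ cong (5 *_) (m^2≡m*m (suc u)) ⟨
    5 * suc u ^ 2                       ∎
    where
    square : ∀ a → (a + 1) * (a + 1) ≡ a * a + (2 * a + 1)
    square = solve-∀
    collect : ∀ u → 5 * (u * u) + 4 + (10 * u + 1) ≡ 5 * (suc u * suc u)
    collect = solve-∀
    identity : ∀ v w → 10 * (v + w) + 1 ≡ (2 * (v + w + 2 * v) + 1) + (4 * v + 8 * w)
    identity = solve-∀
    2a≤10u : 2 * a + 1 ≤ 10 * u + 1
    2a≤10u = subst (2 * a + 1 ≤_) (sym (identity v w)) (m≤m+n _ _)

  above : 5 * suc u ^ 2 < (2 * suc (suc (u + v)) ∸ suc u) ^ 2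
  above = begin-strict
    5 * suc u ^ 2                       ≡⟨ cong (5 *_) (m^2≡m*m (suc u)) ⟩
    5 * (suc u * suc u)                 ≡⟨ expand u ⟩
    5 * (u * u) + (10 * u + 5)          <⟨ +-mono-≤-< (proj₂ bounds) 10u<6a ⟩
    a * a + 4 + (6 * a + 5)             ≡⟨ square a ⟩
    (a + 3) * (a + 3)                   ≡⟨ trans (cong (_^ 2) (shift 1)) (m^2≡m*m (a + 3)) ⟨
    (2 * suc (suc (u + v)) ∸ suc u) ^ 2 ∎
    where
    expand : ∀ u → 5 * (suc u * suc u) ≡ 5 * (u * u) + (10 * u + 5)
    expand = solve-∀
    square : ∀ a → a * a + 4 + (6 * a + 5) ≡ (a + 3) * (a + 3)
    square = solve-∀
    split : ∀ v w → suc (10 * (v + w) + 5) ≡ (10 * v + 6 * w + 5) + (4 * w + 1)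
    split = solve-∀
    join : ∀ v w → (10 * v + 6 * w + 5) + (4 * v + 4 * v) ≡ 6 * (v + w + 2 * v) + 5
    join = solve-∀
    10u<6a : 10 * u + 5 < 6 * a + 5
    10u<6a = subst₂ _≤_ (sym (split v w)) (join v w)
               (+-monoʳ-≤ (10 * v + 6 * w + 5)
                          (+-mono-≤ (*-monoʳ-≤ 4 w≤v) (≤-trans 1≤v (m≤n*m v 4))))

1≤fib-suc : ∀ k → 1 ≤ fib (suc k)
1≤fib-suc zero = ≤-refl
1≤fib-suc (suc k) = ≤-trans (1≤fib-suc k) (m≤m+n _ _)

fib-≤-suc : ∀ k → fib k ≤ fib (suc k)
fib-≤-suc zero = z≤n
fib-≤-suc (suc k) = m≤m+n (fib (suc k)) (fib k)

floorPhi-fib : ∀ k → floorPhi (suc (fib (2 + k))) ≡ suc (fib (3 + k))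
floorPhi-fib k = floorPhi-cassini (fib (1 + k)) (fib k) (1≤fib-suc k) (fib-≤-suc k) (cassini k)

FibonacciLike : (ℕ → ℕ) → Set
FibonacciLike f = ∀ t → f (2 + t) ≡ f (1 + t) + f t

minChain-fibonacci : ∀ {k} f i r m → FibonacciLike f → i + r ≡ suc k →
  minChain k i (f 1) (f 0) (r + m) ≡ applyUpTo f r ++ minChain k (suc k) (f (suc r)) (f r) m
minChain-fibonacci {k} f i zero m _ i+0≡ =
  cong (λ j → minChain k j (f 1) (f 0) m) (trans (sym (+-identityʳ i)) i+0≡)
minChain-fibonacci {k} f i (suc r) m rec i+r≡ = cong (f 0 ∷_) (begin
  minChain k (suc i) (f 1 + f 0) (f 1 + gap k i) (r + m)
    ≡⟨ cong₂ (λ s d → minChain k (suc i) s d (r + m))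
             (sym (rec 0)) (trans (cong (f 1 +_) (gap-≤ i≤k)) (+-identityʳ (f 1))) ⟩
  minChain k (suc i) (f 2) (f 1) (r + m)
    ≡⟨ minChain-fibonacci (f ∘ suc) (suc i) r m (rec ∘ suc) i+r≡′ ⟩
  applyUpTo (f ∘ suc) r ++ minChain k (suc k) (f (2 + r)) (f (suc r)) m ∎)
  where
  open ≡-Reasoning
  i+r≡′ = trans (sym (+-suc i r)) i+r≡
  i≤k = subst (i ≤_) (suc-injective i+r≡′) (m≤m+n i r)

minChain-wythoff : ∀ {k} f i s m → FibonacciLike f → k < i → suc s ≡ f 1 →
                   minChain k i s (f 0) m ≡ applyUpTo f m
minChain-wythoff f i s zero _ _ _ = refl
minChain-wythoff {k} f i s (suc m) rec k<i s+1≡ = cong (f 0 ∷_) (begin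
  minChain k (suc i) (s + f 0) (s + gap k i) m
    ≡⟨ cong (λ d → minChain k (suc i) (s + f 0) d m)
            (trans (cong (s +_) (gap-> k<i)) (trans (+-comm s 1) s+1≡)) ⟩
  minChain k (suc i) (s + f 0) (f 1) m
    ≡⟨ minChain-wythoff (f ∘ suc) (suc i) (s + f 0) m (rec ∘ suc) (m<n⇒m<1+n k<i)
                        (trans (cong (_+ f 0) s+1≡) (sym (rec 0))) ⟩
  applyUpTo (f ∘ suc) m ∎)
  where open ≡-Reasoning

pmin≡minSequence : ∀ n k → pmin n k ≡ minSequence k (suc k + (n ∸ k ∸ 2))
pmin≡minSequence n k = cong (1 ∷_) (sym (begin
  minChain k 0 1 1 (suc k + M)
    ≡⟨ minChain-fibonacci (fib ∘ suc) 0 (suc k) M (λ _ → refl) refl ⟩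
  applyUpTo (fib ∘ suc) (suc k) ++ minChain k (suc k) (fib (3 + k)) (fib (2 + k)) M
    ≡⟨ cong (applyUpTo (fib ∘ suc) (suc k) ++_)
            (minChain-wythoff (wythoff (fib (2 + k))) (suc k) (fib (3 + k)) M (λ _ → refl) ≤-refl
                              (sym (floorPhi-fib k))) ⟩
  applyUpTo (fib ∘ suc) (suc k) ++ applyUpTo (wythoff (fib (2 + k))) M ∎))
  where
  open ≡-Reasoning
  M = n ∸ k ∸ 2

pmin-length : ∀ n k → k + 3 ≤ n → suc (suc k + (n ∸ k ∸ 2)) ≡ n
pmin-length (suc zero) zero (s≤s ())
pmin-length (suc (suc zero)) zero (s≤s (s≤s ()))
pmin-length (suc (suc (suc n))) zero _ = refl
pmin-length (suc n) (suc k) (s≤s k+3≤n) = cong suc (pmin-length n k k+3≤n)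

minSequence-minimizing : ∀ {n} k L → suc L ≡ n → 3 ≤ n → k ≤ n ∸ 3 →
                         Minimizing n k (minSequence k L)
minSequence-minimizing k L refl (s≤s 2≤L) k≤L∸2 =
  minSequence-∈M k L 2≤L k≤L∸2 , minSequence-minimal k L

theorem2 : (n k : ℕ) → 3 ≤ n → k ≤ n ∸ 3 →
    InM n k (pmin n k) ×
    (∀ (P : List ℕ) → InM n k P →
      ∀ (T T′ : Tree) → HuffmanTree (pmin n k) T → HuffmanTree P T′ → E T ≤ E T′)
theorem2 n k 3≤n k≤n∸3 =
  subst (Minimizing n k) (sym (pmin≡minSequence n k))
        (minSequence-minimizing k _ (pmin-length n k (m≤o∸n⇒m+n≤o k 3≤n k≤n∸3)) 3≤n k≤n∸3)
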